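{- There is a $2\times 3$ matrix $A$ with integer entries which is doubly image partition regular but such that there does not exist a positive integer $b$ for which the $2\times 5$ matrix $(\,A\ \ -bI_2\,)$ is kernel partition regular, where $I_2$ is the $2\times2$ identity matrix.
   Context: $\mathbb{N}$ denotes the set of positive integers. A finite colouring of $\mathbb{N}$ is a map $\varphi:\mathbb{N}\to\{1,\ldots,r\}$ for some $r\in\mathbb{N}$; a vector is monochromatic if $\varphi$ is constant on its entries. A $u\times v$ rational matrix $M$ is kernel partition regular if whenever $\mathbb{N}$ is finitely coloured there exists a monochromatic $\vec x\in\mathbb{N}^v$ with $M\vec x=\vec 0$. A $u\times v$ rational matrix $A$ is doubly image partition regular if whenever $\mathbb{N}$ is finitely coloured there exists a monochromatic $\vec x\in\mathbb{N}^v$ such that the entries of $A\vec x$ are also monochromatic (possibly with a different colour from that of $\vec x$). -}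

module Defs where

open import Data.Nat using (ℕ; suc; _>_)
open import Data.Integer using (ℤ; +_; _+_; _*_; -_; 0ℤ)
open import Data.Fin using (Fin; zero; suc)
open import Data.Product using (Σ; _×_; ∃-syntax)
open import Relation.Binary.PropositionalEquality using (_≡_)
import Data.Nat
import Data.Fin
import Data.Sum
import Relation.Nullary

Matrix : ℕ → ℕ → Set
Matrix u v = Fin u → Fin v → ℤ

∑ : ∀ {n} → (Fin n → ℤ) → ℤ
∑ {ℕ.zero} f = 0ℤ
∑ {suc n} f = f zero + ∑ (λ i → f (suc i))

_·_ : ∀ {u v} → Matrix u v → (Fin v → ℕ) → Fin u → ℤ
(M · x) i = ∑ (λ j → M i j * + x j)

-- A finite colouring of ℕ (positive integers) with r colours.
-- Colours of 0 are irrelevant: all coloured values below are required positive.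
Colouring : ℕ → Set
Colouring r = ℕ → Fin r

Positive : ∀ {v} → (Fin v → ℕ) → Set
Positive x = ∀ j → x j > 0

Monochromatic : ∀ {r v} → Colouring r → (Fin v → ℕ) → Set
Monochromatic {r} c x = Σ (Fin r) λ k → ∀ j → c (x j) ≡ k

KernelPR : ∀ {u v} → Matrix u v → Set
KernelPR {u} {v} M =
  ∀ r (c : Colouring r) → ∃[ x ] (Positive x × Monochromatic c x × (∀ i → (M · x) i ≡ 0ℤ))

DoublyImagePR : ∀ {u v} → Matrix u v → Set
DoublyImagePR {u} {v} A =
  ∀ r (c : Colouring r) → ∃[ x ] ∃[ y ]
    (Positive x × Monochromatic c x × Positive y × Monochromatic c y
     × (∀ i → (A · x) i ≡ + y i))

augment : ∀ {u v} → Matrix u v → ℕ → Matrix u (v Data.Nat.+ u)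
augment {u} {v} A b i j with Data.Fin.splitAt v j
... | Data.Sum.inj₁ j' = A i j'
... | Data.Sum.inj₂ k with i Data.Fin.≟ k
...   | Relation.Nullary.yes _ = - (+ b)
...   | Relation.Nullary.no _ = 0ℤ

module Submission where

open import Defs
open import Data.Nat using (ℕ; _>_)
open import Data.Product using (Σ; _×_; _,_)
open import Relation.Nullary using (¬_)

-- Take A with rows (−3, −1, 3) and (−1, 0, 1). Then A (s, 2d, s + d) = (d, d), so A is doubly
-- image partition regular because every finite colouring has s, d > 0 with s, s + d, 2d of
-- one colour; this follows from van der Waerden's theorem by Brauer's induction on the
-- number of colours. On the other hand a kernel vector x of (A  −bI) satisfies
-- x₁ + b x₃ = 3b x₄, an equation violating Rado's columns condition: no nonempty subset of
-- {1, b, −3b} sums to 0. With K = 3b + 1, colour n = 2^k o (o odd) by k mod K and o mod 2^K.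
-- In a monochromatic solution, dividing out the common power of 2 leaves exponents that are
-- 0 or at least K, so modulo 2^K the equation reads (ε₁ + b ε₂ − 3b ε₃) o ≡ 0 with
-- εᵢ ∈ {0, 1} not all 0; as o is odd and 0 < |ε₁ + b ε₂ − 3b ε₃| < 2^K, this is impossible.

module VanDerWaerden where

  open import Data.Nat using (zero; suc; _+_; _*_; _^_; _≤_; _<_; z≤n; s≤s)
  open import Data.Nat.Properties
  open import Data.Nat.Tactic.RingSolver using (solve-∀)
  open import Data.Fin using (Fin; zero; suc; toℕ; fromℕ<; finToFun; funToFin)
  open import Data.Fin.Properties using (toℕ-fromℕ<; finToFun-funToFin; any?; pigeonhole)
    renaming (_≟_ to _≟ᶠ_)
  open import Data.Vec.Functional using (_∷_)
  open import Data.Product using (∃; ∃₂)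
  open import Data.Sum using (_⊎_; inj₁; inj₂; [_,_]′)
  open import Data.Empty using (⊥; ⊥-elim)
  open import Function using (id; _∘_)
  open import Relation.Nullary using (Dec; yes; no)
  open import Relation.Binary.PropositionalEquality

  private variable
    r L s f n N : ℕ
    c : ℕ → Fin r

  MonochromaticAP : (ℕ → Fin r) → (L a d : ℕ) → Set
  MonochromaticAP c L a d = ∀ i → i < L → c (a + i * d) ≡ c a

  -- The bound is on the first term past the progression, which is where colour focusing looks.
  MonochromaticAPBelow : (ℕ → Fin r) → (L N : ℕ) → Set
  MonochromaticAPBelow c L N = ∃₂ λ a d → 0 < d × a + L * d < N × MonochromaticAP c L a d

  VanDerWaerdenBound : (L r : ℕ) → Set
  VanDerWaerdenBound L r = ∃ λ N → ∀ (c : ℕ → Fin r) → MonochromaticAPBelow c L N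

  -- Steps may be 0; they become positive when the family is spread over blocks.
  record ColourFocused (c : ℕ → Fin r) (L s f : ℕ) : Set where
    field
      start step : Fin s → ℕ
      colour : Fin s → Fin r
      focused : ∀ j → start j + L * step j ≡ f
      monochromatic : ∀ j i → i < L → c (start j + i * step j) ≡ colour j
      colour-injective : ∀ j k → colour j ≡ colour k → j ≡ k

  record FreshlyFocusedBelow (c : ℕ → Fin r) (L s N : ℕ) : Set where
    field
      focus : ℕ
      focus<N : focus < N
      family : ColourFocused c L s focus
      focus-fresh : ∀ j → c focus ≢ ColourFocused.colour family j

  colourFocused-empty : ColourFocused c L 0 0
  colourFocused-empty = record
    { start = λ () ; step = λ () ; colour = λ () ; focused = λ ()
    ; monochromatic = λ () ; colour-injective = λ () }

  colourFocused-add-focus : (F : ColourFocused c L s f) → (∀ j → c f ≢ ColourFocused.colour F j) →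
                            ColourFocused c L (suc s) f
  colourFocused-add-focus {c = c} {L = L} {f = f} F fresh = record
    { start = f ∷ start
    ; step = 0 ∷ step
    ; colour = c f ∷ colour
    ; focused = λ { zero → f+i*0≡f L ; (suc j) → focused j }
    ; monochromatic = λ { zero i _ → cong c (f+i*0≡f i) ; (suc j) → monochromatic j }
    ; colour-injective = injective
    }
    where
    open ColourFocused F
    f+i*0≡f : ∀ i → f + i * 0 ≡ f
    f+i*0≡f i = trans (cong (f +_) (*-zeroʳ i)) (+-identityʳ f)
    injective : ∀ j k → (c f ∷ colour) j ≡ (c f ∷ colour) k → j ≡ k
    injective zero    zero    _  = refl
    injective zero    (suc k) eq = ⊥-elim (fresh k eq)
    injective (suc j) zero    eq = ⊥-elim (fresh j (sym eq))
    injective (suc j) (suc k) eq = cong suc (colour-injective j k eq)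

  block-shift : ∀ t n e a d i → t * n + a + i * (d + e * n) ≡ (t + i * e) * n + (a + i * d)
  block-shift = solve-∀

  colourFocused-spread : ∀ {t e} → (∀ i u → i < L → u < n → c ((t + i * e) * n + u) ≡ c (t * n + u)) →
                         f < n → ColourFocused (λ u → c (t * n + u)) L s f →
                         ColourFocused c L s ((t + L * e) * n + f)
  colourFocused-spread {L = L} {n = n} {c = c} {t = t} {e} same-blocks f<n F = record
    { start = λ j → t * n + start j
    ; step = λ j → step j + e * n
    ; colour = colour
    ; focused = λ j → trans (block-shift t n e (start j) (step j) L) (cong ((t + L * e) * n +_) (focused j))
    ; monochromatic = λ j i i<L → begin
        c (t * n + start j + i * (step j + e * n))   ≡⟨ cong c (block-shift t n e (start j) (step j) i) ⟩
        c ((t + i * e) * n + (start j + i * step j)) ≡⟨ same-blocks i _ i<L (offset<n j i (<⇒≤ i<L)) ⟩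
        c (t * n + (start j + i * step j))           ≡⟨ monochromatic j i i<L ⟩
        colour j                                     ∎
    ; colour-injective = colour-injective
    }
    where
    open ColourFocused F
    open ≡-Reasoning
    offset<n : ∀ j i → i ≤ L → start j + i * step j < n
    offset<n j i i≤L = ≤-<-trans (subst (start j + i * step j ≤_) (focused j)
                                          (+-monoʳ-≤ (start j) (*-monoˡ-≤ (step j) i≤L))) f<n

  next-term : ∀ a L d → a + suc (suc L) * d ≡ a + suc L * d + d
  next-term = solve-∀

  colourFocused-extend : (F : ColourFocused c (suc L) s f) → ∀ j → 0 < ColourFocused.step F j →
                         c f ≡ ColourFocused.colour F j → MonochromaticAPBelow c (suc (suc L)) (suc (f + f))
  colourFocused-extend {c = c} {L = L} {f = f} F j d>0 cf≡ = start j , step j , d>0 , s≤s bound , progression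
    where
    open ColourFocused F
    colour-start : c (start j) ≡ colour j
    colour-start = trans (cong c (sym (+-identityʳ (start j)))) (monochromatic j 0 (s≤s z≤n))
    progression : MonochromaticAP c (suc (suc L)) (start j) (step j)
    progression i i<L+2 with m<1+n⇒m<n∨m≡n i<L+2
    ... | inj₁ i<L+1 = trans (monochromatic j i i<L+1) (sym colour-start)
    ... | inj₂ refl  = trans (cong c (focused j)) (trans cf≡ (sym colour-start))
    step≤f : step j ≤ f
    step≤f = subst (step j ≤_) (focused j) (≤-trans (m≤m+n (step j) (L * step j)) (m≤n+m _ (start j)))
    bound : start j + suc (suc L) * step j ≤ f + f
    bound = subst (_≤ f + f) (sym (trans (next-term (start j) L (step j)) (cong (_+ step j) (focused j))))
                  (+-monoʳ-≤ f step≤f)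

  monochromaticAPBelow-shift : ∀ m → MonochromaticAPBelow (λ u → c (m + u)) L N →
                               MonochromaticAPBelow c L (m + N)
  monochromaticAPBelow-shift {c = c} {L = L} {N = N} m (a , d , d>0 , bound , progression) =
    m + a , d , d>0 , subst (_< m + N) (sym (+-assoc m a (L * d))) (+-monoʳ-< m bound) ,
    λ i i<L → trans (cong c (+-assoc m a (i * d))) (progression i i<L)

  monochromaticAPBelow-mono : ∀ {N′} → N ≤ N′ → MonochromaticAPBelow c L N → MonochromaticAPBelow c L N′
  monochromaticAPBelow-mono N≤N′ (a , d , d>0 , bound , progression) =
    a , d , d>0 , <-≤-trans bound N≤N′ , progression

  blocks : (ℕ → Fin r) → (n : ℕ) → ℕ → Fin (r ^ n)
  blocks c n t = funToFin (λ (u : Fin n) → c (t * n + toℕ u))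

  blocks-≡ : ∀ {r} {c : ℕ → Fin r} {t t′ u} → blocks c n t ≡ blocks c n t′ → u < n →
             c (t * n + u) ≡ c (t′ * n + u)
  blocks-≡ {n = n} {r} {c} {t = t} {t′ = t′} {u = u} same u<n = begin
    c (t * n + u)            ≡⟨ entry t ⟨
    entryAt (blocks c n t)   ≡⟨ cong entryAt same ⟩
    entryAt (blocks c n t′)  ≡⟨ entry t′ ⟩
    c (t′ * n + u)           ∎
    where
    open ≡-Reasoning
    entryAt : Fin (r ^ n) → Fin r
    entryAt b = finToFun b (fromℕ< u<n)
    entry : ∀ t → entryAt (blocks c n t) ≡ c (t * n + u)
    entry t = trans (finToFun-funToFin _ (fromℕ< u<n)) (cong (λ v → c (t * n + v)) (toℕ-fromℕ< u<n))

  t*n+u<M*n : ∀ {t M u} → t < M → u < n → t * n + u < M * n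
  t*n+u<M*n {n = n} {t = t} {M = M} {u = u} t<M u<n = begin-strict
    t * n + u  <⟨ +-monoʳ-< (t * n) u<n ⟩
    t * n + n  ≡⟨ +-comm (t * n) n ⟩
    suc t * n  ≤⟨ *-monoˡ-≤ n t<M ⟩
    M * n      ∎
    where open ≤-Reasoning

  FocusingOutcome : (ℕ → Fin r) → (L s N : ℕ) → Set
  FocusingOutcome c L s N = MonochromaticAPBelow c (suc L) N ⊎ FreshlyFocusedBelow c L s N

  module FocusingStep {L n M t e} (c : ℕ → Fin r) (e>0 : 0 < e) (t+[1+L]e<M : t + suc L * e < M)
                      (same : MonochromaticAP (blocks c n) (suc L) t e) where

    found : MonochromaticAPBelow (λ u → c (t * n + u)) (suc (suc L)) n →
            FocusingOutcome c (suc L) s (M * n + M * n)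
    found progression =
      inj₁ (monochromaticAPBelow-mono t*n+n≤2Mn (monochromaticAPBelow-shift (t * n) progression))
      where
      t<M : t < M
      t<M = ≤-<-trans (m≤m+n t _) t+[1+L]e<M
      t*n+n≤2Mn : t * n + n ≤ M * n + M * n
      t*n+n≤2Mn = ≤-trans (subst (_≤ M * n) (+-comm n (t * n)) (*-monoˡ-≤ n t<M)) (m≤m+n _ _)

    spread : ∀ {s} → FreshlyFocusedBelow (λ u → c (t * n + u)) (suc L) s n →
             FocusingOutcome c (suc L) (suc s) (M * n + M * n)
    spread {s} F = decide (any? (λ j → c f′ ≟ᶠ ColourFocused.colour family′ j))
      where
      open FreshlyFocusedBelow F
      f′ : ℕ
      f′ = (t + suc L * e) * n + focus
      family′ : ColourFocused c (suc L) (suc s) f′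
      family′ = colourFocused-spread {t = t} {e = e} same-blocks focus<N (colourFocused-add-focus family focus-fresh)
        where
        same-blocks : ∀ i u → i < suc L → u < n → c ((t + i * e) * n + u) ≡ c (t * n + u)
        same-blocks i u i<L u<n = blocks-≡ {c = c} {t = t + i * e} {t′ = t} (same i i<L) u<n
      f′<Mn : f′ < M * n
      f′<Mn = t*n+u<M*n t+[1+L]e<M focus<N
      step-positive : ∀ j → 0 < ColourFocused.step family′ j
      step-positive j = <-≤-trans (*-mono-< e>0 (≤-<-trans z≤n focus<N)) (m≤n+m _ _)
      decide : Dec (∃ λ j → c f′ ≡ ColourFocused.colour family′ j) →
               FocusingOutcome c (suc L) (suc s) (M * n + M * n)
      decide (yes (j , same-colour)) = inj₁ (monochromaticAPBelow-mono (+-mono-≤ f′<Mn (<⇒≤ f′<Mn))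
                                              (colourFocused-extend family′ j (step-positive j) same-colour))
      decide (no fresh) = inj₂ record
        { focus = f′ ; focus<N = <-≤-trans f′<Mn (m≤m+n _ _) ; family = family′
        ; focus-fresh = λ j same-colour → fresh (j , same-colour) }

  focusing : (∀ r → VanDerWaerdenBound (suc L) r) → ∀ r s → ∃ λ N → ∀ (c : ℕ → Fin r) →
             FocusingOutcome c (suc L) s N
  focusing vdW r zero = 1 , λ c → inj₂ record
    { focus = 0 ; focus<N = s≤s z≤n ; family = colourFocused-empty ; focus-fresh = λ () }
  focusing {L = L} vdW r (suc s) with focusing vdW r s
  ... | n , recurse with vdW (r ^ n)
  ... | M , block-progression = M * n + M * n , λ c → step c (block-progression (blocks c n))
    where
    step : ∀ c → MonochromaticAPBelow (blocks c n) (suc L) M →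
           FocusingOutcome c (suc L) (suc s) (M * n + M * n)
    step c (t , e , e>0 , bound , same) = [ found , spread ]′ (recurse (λ u → c (t * n + u)))
      where open FocusingStep {L = L} {n = n} {M = M} {t = t} {e = e} c e>0 bound same

  vanDerWaerden : ∀ L r → VanDerWaerdenBound (suc L) r
  vanDerWaerden zero r =
    2 , λ c → 0 , 1 , s≤s z≤n , s≤s (s≤s z≤n) , λ { zero _ → refl ; (suc _) (s≤s ()) }
  vanDerWaerden (suc L) r with focusing (vanDerWaerden L) r (suc r)
  ... | N , progression-or-focused = N , λ c → [ id , ⊥-elim ∘ too-many-colours ]′ (progression-or-focused c)
    where
    too-many-colours : {c : ℕ → Fin r} → FreshlyFocusedBelow c (suc L) (suc r) N → ⊥
    too-many-colours F =
      let i , j , i<j , same = pigeonhole (n<1+n r) colour in <-irrefl (cong toℕ (colour-injective i j same)) i<j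
      where open ColourFocused (FreshlyFocusedBelow.family F)

module MonochromaticTriples where

  open import Data.Nat using (zero; suc; _+_; _*_; _≤_; _<_; z≤n; s≤s)
  open import Data.Nat.Properties
  open import Data.Nat.Tactic.RingSolver using (solve-∀)
  open import Data.Fin using (Fin; zero; suc; punchOut)
  open import Data.Fin.Properties using (punchOut-injective) renaming (_≟_ to _≟ᶠ_)
  open import Data.Product using (∃; ∃₂)
  open import Data.Empty using (⊥-elim)
  open import Function using (_∘_)
  open import Relation.Nullary using (Dec; yes; no)
  open import Relation.Binary.PropositionalEquality
  open VanDerWaerden using (MonochromaticAP; MonochromaticAPBelow; vanDerWaerden)

  MonochromaticTriple : ∀ {r} → (ℕ → Fin r) → ℕ → Set
  MonochromaticTriple c N =
    ∃₂ λ s d → 0 < s × 0 < d × s + d ≤ N × 2 * d ≤ N × c (s + d) ≡ c s × c (2 * d) ≡ c s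

  -- Injective away from α; the value at α itself is junk.
  squeeze : ∀ {n} (α β : Fin (suc (suc n))) → Fin (suc n)
  squeeze α β with α ≟ᶠ β
  ... | yes _   = zero
  ... | no α≢β = punchOut α≢β

  squeeze-injective : ∀ {n} {α β γ : Fin (suc (suc n))} → α ≢ β → α ≢ γ →
                      squeeze α β ≡ squeeze α γ → β ≡ γ
  squeeze-injective {α = α} {β} {γ} α≢β α≢γ same with α ≟ᶠ β | α ≟ᶠ γ
  ... | yes α≡β | _       = ⊥-elim (α≢β α≡β)
  ... | no _    | yes α≡γ = ⊥-elim (α≢γ α≡γ)
  ... | no α≢β′ | no α≢γ′ = punchOut-injective α≢β′ α≢γ′ same

  double-+ : ∀ s e d → 2 * (s * d) + 2 * (e * d) ≡ 2 * ((s + e) * d)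
  double-+ = solve-∀

  double-double : ∀ e d → 2 * (2 * (e * d)) ≡ 2 * ((2 * e) * d)
  double-double = solve-∀

  0<2* : ∀ {x} → 0 < x → 0 < 2 * x
  0<2* {x} x>0 = ≤-trans x>0 (m≤m+n x _)

  -- Brauer's step: s, s + d, …, s + K d all have the colour α of s = a + 1. If some 2 k d
  -- (1 ≤ k ≤ K) also has colour α, then (s, k d) is a triple; otherwise k ↦ colour of 2 k d
  -- avoids α, and a triple for that colouring with one colour fewer scales by 2 d.
  module BrauerStep {r K N a d} (c : ℕ → Fin (suc (suc r))) (d>0 : 0 < d) (a+[1+K]d<N : a + suc K * d < N)
                    (same : MonochromaticAP (c ∘ suc) (suc K) a d) where

    α : Fin (suc (suc r))
    α = c (suc a)

    double : ℕ → ℕ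
    double k = 2 * (k * d)

    recolouring : ℕ → Fin (suc r)
    recolouring k = squeeze α (c (double k))

    N′ : ℕ
    N′ = N + 2 * (K * N)

    double-≤ : ∀ {k} → k ≤ K → double k ≤ N′
    double-≤ k≤K = ≤-trans (*-monoʳ-≤ 2 (*-mono-≤ k≤K d≤N)) (m≤n+m _ N)
      where
      d≤N : d ≤ N
      d≤N = ≤-trans (m≤m+n d (K * d)) (≤-trans (m≤n+m _ a) (<⇒≤ a+[1+K]d<N))

    direct : ∀ k → 0 < k → k ≤ K → α ≡ c (double k) → MonochromaticTriple c N′
    direct k k>0 k≤K α≡ =
      suc a , k * d , s≤s z≤n , *-mono-< k>0 d>0 , ≤-trans a+kd<N (m≤m+n N _) , double-≤ k≤K ,
      same k (s≤s k≤K) , sym α≡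
      where
      a+kd<N : a + k * d < N
      a+kd<N = begin-strict
        a + k * d      ≤⟨ +-monoʳ-≤ a (*-monoˡ-≤ d k≤K) ⟩
        a + K * d      <⟨ +-monoʳ-< a (m<n+m (K * d) d>0) ⟩
        a + suc K * d  <⟨ a+[1+K]d<N ⟩
        N              ∎
        where open ≤-Reasoning

    recoloured : MonochromaticTriple recolouring K → MonochromaticTriple c N′
    recoloured (s , e , s>0 , e>0 , s+e≤K , 2e≤K , same-sum , same-double) =
      decide (α ≟ᶠ c (double s)) (α ≟ᶠ c (double (s + e))) (α ≟ᶠ c (double (2 * e)))
      where
      decide : Dec (α ≡ c (double s)) → Dec (α ≡ c (double (s + e))) → Dec (α ≡ c (double (2 * e))) →
               MonochromaticTriple c N′
      decide (yes α≡) _ _ = direct s s>0 (≤-trans (m≤m+n s e) s+e≤K) α≡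
      decide (no _) (yes α≡) _ = direct (s + e) (≤-trans s>0 (m≤m+n s e)) s+e≤K α≡
      decide (no _) (no _) (yes α≡) = direct (2 * e) (0<2* e>0) 2e≤K α≡
      decide (no α≢s) (no α≢s+e) (no α≢2e) =
        double s , double e , 0<2* (*-mono-< s>0 d>0) , 0<2* (*-mono-< e>0 d>0) ,
        subst (_≤ N′) (sym (double-+ s e d)) (double-≤ s+e≤K) ,
        subst (_≤ N′) (sym (double-double e d)) (double-≤ 2e≤K) ,
        trans (cong c (double-+ s e d)) (squeeze-injective α≢s+e α≢s same-sum) ,
        trans (cong c (double-double e d)) (squeeze-injective α≢2e α≢s same-double)

  monochromaticTriple : ∀ r → ∃ λ N → ∀ (c : ℕ → Fin (suc r)) → MonochromaticTriple c N
  monochromaticTriple zero = 2 , λ c → 1 , 1 , s≤s z≤n , s≤s z≤n , ≤-refl , ≤-refl , one-colour , one-colour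
    where
    one-colour : {i j : Fin 1} → i ≡ j
    one-colour {zero} {zero} = refl
  monochromaticTriple (suc r) with monochromaticTriple r
  ... | K , triple with vanDerWaerden K (suc (suc r))
  ... | N , progression = N + 2 * (K * N) , λ c → step c (progression (c ∘ suc))
    where
    step : ∀ c → MonochromaticAPBelow (c ∘ suc) (suc K) N → MonochromaticTriple c (N + 2 * (K * N))
    step c (a , d , d>0 , bound , same) = recoloured (triple recolouring)
      where open BrauerStep c d>0 bound same

module Arithmetic where

  open import Data.Nat using (zero; suc; pred; _+_; _*_; _∸_; _^_; _≤_; _<_; z≤n; s≤s; NonZero; _%_;
                              nonTrivial⇒nonZero)
  open import Data.Nat.Properties
  open import Data.Nat.DivMod using (_/_; _mod_; m≡m%n+[m/n]*n; m%n<n; %-distribˡ-+; %-distribˡ-*; [m+n]%n≡m%n;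
                                     [m+kn]%n≡m%n; m<n⇒m%n≡m)
  open import Data.Nat.Divisibility
    using (_∣_; _∤_; _∣?_; divides; ∣-trans; m∣m*n; *-cancelˡ-∣; *-monoʳ-∣; 1∣_)
  open import Data.Nat.Primality using (Prime; prime; euclidsLemma)
  open import Data.Nat.Induction using (<-rec)
  open import Data.Fin using (toℕ)
  open import Data.Fin.Properties using (toℕ-fromℕ<)
  open import Data.Sum using (inj₁; inj₂; [_,_]′)
  open import Data.Empty using (⊥-elim)
  open import Relation.Nullary using (yes; no)
  open import Relation.Binary.PropositionalEquality

  module Modular (n : ℕ) .{{_ : NonZero n}} where

    infix 4 _≈_
    _≈_ : ℕ → ℕ → Set
    x ≈ y = x % n ≡ y % n

    mod⇒≈ : ∀ {x y} → x mod n ≡ y mod n → x ≈ y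
    mod⇒≈ {x} {y} eq = trans (sym (toℕ-fromℕ< (m%n<n x n))) (trans (cong toℕ eq) (toℕ-fromℕ< (m%n<n y n)))

    +-cong : ∀ {a a′ b b′} → a ≈ a′ → b ≈ b′ → a + b ≈ a′ + b′
    +-cong {a} {a′} {b} {b′} a≈a′ b≈b′ = begin
      (a + b) % n                ≡⟨ %-distribˡ-+ a b n ⟩
      (a % n + b % n) % n        ≡⟨ cong₂ (λ x y → (x + y) % n) a≈a′ b≈b′ ⟩
      (a′ % n + b′ % n) % n      ≡⟨ %-distribˡ-+ a′ b′ n ⟨
      (a′ + b′) % n              ∎
      where open ≡-Reasoning

    *-congˡ : ∀ k {a a′} → a ≈ a′ → k * a ≈ k * a′
    *-congˡ k {a} {a′} a≈a′ = begin
      (k * a) % n                ≡⟨ %-distribˡ-* k a n ⟩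
      (k % n * (a % n)) % n      ≡⟨ cong (λ x → (k % n * x) % n) a≈a′ ⟩
      (k % n * (a′ % n)) % n     ≡⟨ %-distribˡ-* k a′ n ⟨
      (k * a′) % n               ∎
      where open ≡-Reasoning

    suc-cancel : ∀ {x y} → suc x ≈ suc y → x ≈ y
    suc-cancel {x} {y} sx≈sy = begin
      x % n                      ≡⟨ [m+n]%n≡m%n x n ⟨
      (x + n) % n                ≡⟨ cong (_% n) (shift x) ⟩
      (suc x + pred n) % n       ≡⟨ +-cong sx≈sy refl ⟩
      (suc y + pred n) % n       ≡⟨ cong (_% n) (shift y) ⟨
      (y + n) % n                ≡⟨ [m+n]%n≡m%n y n ⟩
      y % n                      ∎
      where
      open ≡-Reasoning
      shift : ∀ z → z + n ≡ suc z + pred n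
      shift z = trans (cong (z +_) (sym (suc-pred n))) (+-suc z (pred n))

    ≈⇒∣∸ : ∀ {x y} → x ≤ y → x ≈ y → n ∣ y ∸ x
    ≈⇒∣∸ {x} {y} x≤y x≈y = divides (y / n ∸ x / n) (begin
      y ∸ x                                      ≡⟨ cong₂ _∸_ (m≡m%n+[m/n]*n y n) (m≡m%n+[m/n]*n x n) ⟩
      (y % n + y / n * n) ∸ (x % n + x / n * n)  ≡⟨ cong (λ r → (y % n + y / n * n) ∸ (r + x / n * n)) x≈y ⟩
      (y % n + y / n * n) ∸ (y % n + x / n * n)  ≡⟨ [m+n]∸[m+o]≡n∸o (y % n) _ _ ⟩
      y / n * n ∸ x / n * n                      ≡⟨ *-distribʳ-∸ n (y / n) (x / n) ⟨
      (y / n ∸ x / n) * n                        ∎)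
      where open ≡-Reasoning

    ∣∸⇒≈ : ∀ {x y} → x ≤ y → n ∣ y ∸ x → x ≈ y
    ∣∸⇒≈ {x} {y} x≤y (divides q y∸x≡qn) = begin
      x % n             ≡⟨ [m+kn]%n≡m%n x q n ⟨
      (x + q * n) % n   ≡⟨ cong (λ d → (x + d) % n) y∸x≡qn ⟨
      (x + (y ∸ x)) % n ≡⟨ cong (_% n) (m+[n∸m]≡n x≤y) ⟩
      y % n             ∎
      where open ≡-Reasoning

    ≈⇒≡ : ∀ {x y} → x < n → y < n → x ≈ y → x ≡ y
    ≈⇒≡ {x} {y} x<n y<n x≈y = trans (sym (m<n⇒m%n≡m x<n)) (trans x≈y (m<n⇒m%n≡m y<n))

    *-cancelʳ-≈ : ∀ o → (∀ {d} → n ∣ d * o → n ∣ d) → ∀ {x y} → x * o ≈ y * o → x ≈ y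
    *-cancelʳ-≈ o cancel {x} {y} xo≈yo =
      [ from-≤ xo≈yo , (λ y≤x → sym (from-≤ (sym xo≈yo) y≤x)) ]′ (≤-total x y)
      where
      from-≤ : ∀ {x y} → x * o ≈ y * o → x ≤ y → x ≈ y
      from-≤ {x} {y} xo≈yo x≤y =
        ∣∸⇒≈ x≤y (cancel (subst (n ∣_) (sym (*-distribʳ-∸ o y x))
                                 (≈⇒∣∸ (*-monoˡ-≤ o x≤y) xo≈yo)))

  prime^k-∣-cancelʳ : ∀ {p} → Prime p → ∀ k {m o} → p ∤ o → p ^ k ∣ m * o → p ^ k ∣ m
  prime^k-∣-cancelʳ _ zero {m} _ _ = 1∣ m
  prime^k-∣-cancelʳ {p} pp@(prime _) (suc k) {m} {o} p∤o p^[1+k]∣mo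
    with euclidsLemma m o pp (∣-trans (m∣m*n (p ^ k)) p^[1+k]∣mo)
  ... | inj₂ p∣o = ⊥-elim (p∤o p∣o)
  ... | inj₁ (divides q refl) =
    subst (p ^ suc k ∣_) (*-comm p q) (*-monoʳ-∣ p (prime^k-∣-cancelʳ pp k p∤o p^k∣qo))
    where
    p^k∣qo : p ^ k ∣ q * o
    p^k∣qo = *-cancelˡ-∣ p {{nonTrivial⇒nonZero p}}
               (subst (p ^ suc k ∣_) (trans (cong (_* o) (*-comm q p)) (*-assoc p q o)) p^[1+k]∣mo)

  n<2^n : ∀ n → n < 2 ^ n
  n<2^n zero    = s≤s z≤n
  n<2^n (suc n) = +-mono-≤ (m^n>0 2 n) (≤-trans (n<2^n n) (m≤m+n (2 ^ n) 0))

  record OddDecomposition (n : ℕ) : Set where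
    field
      exponent oddPart : ℕ
      oddPart-odd : 2 ∤ oddPart
      decomposition : n ≡ 2 ^ exponent * oddPart

  oddDecomposition : ∀ n → 0 < n → OddDecomposition n
  oddDecomposition = <-rec (λ n → 0 < n → OddDecomposition n) split
    where
    split : ∀ n → (∀ {m} → m < n → 0 < m → OddDecomposition m) → 0 < n → OddDecomposition n
    split n halve n>0 with 2 ∣? n
    ... | no 2∤n = record
      { exponent = 0 ; oddPart = n ; oddPart-odd = 2∤n ; decomposition = sym (*-identityˡ n) }
    ... | yes (divides zero n≡0) = ⊥-elim (<⇒≢ n>0 (sym n≡0))
    ... | yes (divides q@(suc _) n≡q*2) = record
      { exponent = suc exponent ; oddPart = oddPart ; oddPart-odd = oddPart-odd
      ; decomposition = begin
          n                          ≡⟨ n≡q*2 ⟩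
          q * 2                      ≡⟨ *-comm q 2 ⟩
          2 * q                      ≡⟨ cong (2 *_) decomposition ⟩
          2 * (2 ^ exponent * oddPart) ≡⟨ *-assoc 2 (2 ^ exponent) oddPart ⟨
          2 ^ suc exponent * oddPart ∎ }
      where
      open ≡-Reasoning
      open OddDecomposition (halve (subst (q <_) (sym n≡q*2) (m<m*n q 2 ≤-refl)) (s≤s z≤n))

  ^-monoʳ-∣ : ∀ p {m n} → m ≤ n → p ^ m ∣ p ^ n
  ^-monoʳ-∣ p {m} {n} m≤n = divides (p ^ (n ∸ m)) (begin
    p ^ n                 ≡⟨ cong (p ^_) (m+[n∸m]≡n m≤n) ⟨
    p ^ (m + (n ∸ m))     ≡⟨ ^-distribˡ-+-* p m (n ∸ m) ⟩
    p ^ m * p ^ (n ∸ m)   ≡⟨ *-comm (p ^ m) _ ⟩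
    p ^ (n ∸ m) * p ^ m   ∎)
    where open ≡-Reasoning

module TwoAdicColouring (b : ℕ) (b>0 : b > 0) where

  open import Data.Nat using (zero; suc; _+_; _*_; _^_; _≤_; _<_; z≤n; s≤s; NonZero; _%_)
  open import Data.Nat.Properties
  open import Data.Nat.DivMod using (_mod_; m*n%n≡0; m<n⇒m%n≡m)
  open import Data.Nat.Divisibility using (_∤_; ∣-trans; m∣m*n; n∣m⇒m%n≡0)
  open import Data.Nat.Primality using (prime[2])
  open import Data.Nat.Tactic.RingSolver using (solve-∀)
  open import Data.Fin using (Fin; combine)
  open import Data.Fin.Properties using (combine-injective)
  open import Data.Product using (proj₁; proj₂)
  open import Data.Sum using (_⊎_; inj₁; inj₂)
  open import Relation.Binary.PropositionalEquality
  open Arithmetic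

  K M : ℕ
  K = suc (3 * b)
  M = 2 ^ K

  instance
    M≢0 : NonZero M
    M≢0 = m^n≢0 2 K

  open Modular K using () renaming (_≈_ to _≈ₖ_; mod⇒≈ to mod⇒≈ₖ; suc-cancel to suc-cancelₖ)
  open Modular M using ()
    renaming (_≈_ to _≈ₘ_; mod⇒≈ to mod⇒≈ₘ; +-cong to +-congₘ; *-congˡ to *-congˡₘ; ≈⇒≡ to ≈⇒≡ₘ;
              *-cancelʳ-≈ to *-cancelʳ-≈ₘ)

  δ₀ : ℕ → ℕ
  δ₀ zero    = 1
  δ₀ (suc _) = 0

  δ₀≤1 : ∀ k → δ₀ k ≤ 1
  δ₀≤1 zero    = ≤-refl
  δ₀≤1 (suc _) = z≤n

  *-δ₀-≤ : ∀ c k → c * δ₀ k ≤ c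
  *-δ₀-≤ c zero    = ≤-reflexive (*-identityʳ c)
  *-δ₀-≤ c (suc _) = subst (_≤ c) (sym (*-zeroʳ c)) z≤n

  power-residue : ∀ k {o} → k ≈ₖ 0 → 2 ^ k * o ≈ₘ δ₀ k * o
  power-residue zero        _   = refl
  power-residue (suc k) {o} k≈0 =
    trans (n∣m⇒m%n≡0 _ M (∣-trans (^-monoʳ-∣ 2 K≤1+k) (m∣m*n o))) (sym (m*n%n≡0 0 M))
    where
    K≤1+k : K ≤ suc k
    K≤1+k = ≮⇒≥ λ 1+k<K → 0≢1+n (trans (sym k≈0) (m<n⇒m%n≡m 1+k<K))

  3[1+m]≡[2+m]+[1+2m] : ∀ m → 3 * suc m ≡ 1 + suc m + suc (2 * m)
  3[1+m]≡[2+m]+[1+2m] = solve-∀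

  1+n<3n : ∀ {n} → n > 0 → 1 + n < 3 * n
  1+n<3n {suc m} _ = subst (1 + suc m <_) (sym (3[1+m]≡[2+m]+[1+2m] m)) (m<m+n _ (s≤s z≤n))

  -- Rado's columns condition fails: no nonempty subset of 1, b, −3b sums to 0.
  columns : ∀ ku kv kw → ku ≡ 0 ⊎ kv ≡ 0 ⊎ kw ≡ 0 → δ₀ ku + b * δ₀ kv ≢ 3 * b * δ₀ kw
  columns ku kv zero _ eq =
    <-irrefl (trans eq (*-identityʳ (3 * b))) (≤-<-trans (+-mono-≤ (δ₀≤1 ku) (*-δ₀-≤ b kv)) (1+n<3n b>0))
  columns zero kv (suc kw) _ eq = 0≢1+n (trans (sym (*-zeroʳ (3 * b))) (sym eq))
  columns (suc ku) zero (suc kw) _ eq =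
    n>0⇒n≢0 (subst (0 <_) (sym (*-identityʳ b)) b>0) (trans eq (*-zeroʳ (3 * b)))
  columns (suc ku) (suc kv) (suc kw) (inj₁ ())
  columns (suc ku) (suc kv) (suc kw) (inj₂ (inj₁ ()))
  columns (suc ku) (suc kv) (suc kw) (inj₂ (inj₂ ()))

  distribute : ∀ x y b o → (x + b * y) * o ≡ x * o + b * (y * o)
  distribute = solve-∀

  halve-left : ∀ P Q ou ov b → 2 * P * ou + b * (2 * Q * ov) ≡ 2 * (P * ou + b * (Q * ov))
  halve-left = solve-∀

  halve-right : ∀ R ow b → 3 * b * (2 * R * ow) ≡ 2 * (3 * b * (R * ow))
  halve-right = solve-∀

  module _ {ou ov ow : ℕ} (ou-odd : 2 ∤ ou) (ov≈ou : ov ≈ₘ ou) (ow≈ou : ow ≈ₘ ou) where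

    residue : ∀ k {o} → k ≈ₖ 0 → o ≈ₘ ou → 2 ^ k * o ≈ₘ δ₀ k * ou
    residue k k≈0 o≈ou = trans (power-residue k k≈0) (*-congˡₘ (δ₀ k) o≈ou)

    no-solution-with-exponent-0 : ∀ ku kv kw → ku ≈ₖ 0 → kv ≈ₖ 0 → kw ≈ₖ 0 →
                                  ku ≡ 0 ⊎ kv ≡ 0 ⊎ kw ≡ 0 →
                                  2 ^ ku * ou + b * (2 ^ kv * ov) ≢ 3 * b * (2 ^ kw * ow)
    no-solution-with-exponent-0 ku kv kw ku≈0 kv≈0 kw≈0 some-zero eq =
      columns ku kv kw some-zero (≈⇒≡ₘ α<M β<M α≈β)
      where
      α β : ℕ
      α = δ₀ ku + b * δ₀ kv
      β = 3 * b * δ₀ kw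
      α≈β : α ≈ₘ β
      α≈β = *-cancelʳ-≈ₘ ou (prime^k-∣-cancelʳ prime[2] K ou-odd) (begin
        α * ou % M                              ≡⟨ cong (_% M) (distribute (δ₀ ku) (δ₀ kv) b ou) ⟩
        (δ₀ ku * ou + b * (δ₀ kv * ou)) % M     ≡⟨ +-congₘ (residue ku ku≈0 refl)
                                                           (*-congˡₘ b (residue kv kv≈0 ov≈ou)) ⟨
        (2 ^ ku * ou + b * (2 ^ kv * ov)) % M   ≡⟨ cong (_% M) eq ⟩
        3 * b * (2 ^ kw * ow) % M               ≡⟨ *-congˡₘ (3 * b) (residue kw kw≈0 ow≈ou) ⟩
        3 * b * (δ₀ kw * ou) % M                ≡⟨ cong (_% M) (*-assoc (3 * b) (δ₀ kw) ou) ⟨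
        β * ou % M                              ∎)
        where open ≡-Reasoning
      K<M : K < M
      K<M = n<2^n K
      α<M : α < M
      α<M = ≤-<-trans (+-mono-≤ (δ₀≤1 ku) (*-δ₀-≤ b kv)) (≤-<-trans (s≤s (m≤m+n b _)) K<M)
      β<M : β < M
      β<M = ≤-<-trans (*-δ₀-≤ (3 * b) kw) (<-trans (n<1+n _) K<M)

    -- Halving a solution lowers every exponent by one.
    no-solution : ∀ ku kv kw → kv ≈ₖ ku → kw ≈ₖ ku →
                  2 ^ ku * ou + b * (2 ^ kv * ov) ≢ 3 * b * (2 ^ kw * ow)
    no-solution (suc ku) (suc kv) (suc kw) kv≈ku kw≈ku eq =
      no-solution ku kv kw (suc-cancelₖ kv≈ku) (suc-cancelₖ kw≈ku) (*-cancelˡ-≡ _ _ 2 (begin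
        2 * (2 ^ ku * ou + b * (2 ^ kv * ov))      ≡⟨ halve-left (2 ^ ku) (2 ^ kv) ou ov b ⟨
        2 ^ suc ku * ou + b * (2 ^ suc kv * ov)    ≡⟨ eq ⟩
        3 * b * (2 ^ suc kw * ow)                  ≡⟨ halve-right (2 ^ kw) ow b ⟩
        2 * (3 * b * (2 ^ kw * ow))                ∎))
      where open ≡-Reasoning
    no-solution zero kv kw kv≈0 kw≈0 =
      no-solution-with-exponent-0 zero kv kw refl kv≈0 kw≈0 (inj₁ refl)
    no-solution (suc ku) zero kw 0≈ku kw≈ku =
      no-solution-with-exponent-0 (suc ku) zero kw (sym 0≈ku) refl (trans kw≈ku (sym 0≈ku))
        (inj₂ (inj₁ refl))
    no-solution (suc ku) (suc kv) zero kv≈ku 0≈ku =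
      no-solution-with-exponent-0 (suc ku) (suc kv) zero (sym 0≈ku) (trans kv≈ku (sym 0≈ku)) refl
        (inj₂ (inj₂ refl))

  colourOf : ∀ {n} → OddDecomposition n → Fin (K * M)
  colourOf d = combine (exponent mod K) (oddPart mod M)
    where open OddDecomposition d

  -- 0 is never coloured meaningfully; it gets the colour of 1.
  colour : ℕ → Fin (K * M)
  colour zero      = colourOf (oddDecomposition 1 (s≤s z≤n))
  colour n@(suc _) = colourOf (oddDecomposition n (s≤s z≤n))

  colour-positive : ∀ n (n>0 : 0 < n) → colour n ≡ colourOf (oddDecomposition n n>0)
  colour-positive (suc n) (s≤s z≤n) = refl

  colour-no-monochromatic-solution : ∀ {u v w} → 0 < u → 0 < v → 0 < w →
                                     colour v ≡ colour u → colour w ≡ colour u → u + b * v ≢ 3 * b * w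
  colour-no-monochromatic-solution {u} {v} {w} u>0 v>0 w>0 cv≡cu cw≡cu eq =
    no-solution {oddPart du} {oddPart dv} {oddPart dw} (oddPart-odd du) (proj₂ v∼u) (proj₂ w∼u)
      (exponent du) (exponent dv) (exponent dw) (proj₁ v∼u) (proj₁ w∼u)
      (subst₂ (λ x y → x + b * y ≡ 3 * b * (2 ^ exponent dw * oddPart dw))
              (decomposition du) (decomposition dv) (trans eq (cong (3 * b *_) (decomposition dw))))
    where
    open OddDecomposition
    du = oddDecomposition u u>0
    dv = oddDecomposition v v>0
    dw = oddDecomposition w w>0
    same-class : ∀ {x} (x>0 : 0 < x) → colour x ≡ colour u → let dx = oddDecomposition x x>0 in
                 exponent dx ≈ₖ exponent du × oddPart dx ≈ₘ oddPart du
    same-class {x} x>0 cx≡cu =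
      mod⇒≈ₖ {exponent dx} {exponent du} (proj₁ same) , mod⇒≈ₘ {oddPart dx} {oddPart du} (proj₂ same)
      where
      dx = oddDecomposition x x>0
      same = combine-injective (exponent dx mod K) (oddPart dx mod M) (exponent du mod K) (oddPart du mod M)
               (trans (sym (colour-positive x x>0)) (trans cx≡cu (colour-positive u u>0)))
    v∼u = same-class {v} v>0 cv≡cu
    w∼u = same-class {w} w>0 cw≡cu

module WitnessMatrix where

  open import Data.Nat using (zero; suc) renaming (_+_ to _+ℕ_; _*_ to _*ℕ_)
  open import Data.Integer using (+_; -[1+_]; 0ℤ; -_; _+_; _-_; _*_)
  open import Data.Integer.Properties using (pos-+; pos-*; +-injective)
  open import Data.Integer.Tactic.RingSolver using (solve-∀)
  open import Data.Fin using (Fin; zero; suc)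
  open import Data.Nat.Properties using (≤-trans; m≤m+n)
  open import Relation.Binary.PropositionalEquality
  open MonochromaticTriples using (monochromaticTriple)

  A : Matrix 2 3
  A zero       zero             = -[1+ 2 ]
  A zero       (suc zero)       = -[1+ 0 ]
  A zero       (suc (suc zero)) = + 3
  A (suc zero) zero             = -[1+ 0 ]
  A (suc zero) (suc zero)       = + 0
  A (suc zero) (suc (suc zero)) = + 1

  configuration : ℕ → ℕ → Fin 3 → ℕ
  configuration s d zero             = s
  configuration s d (suc zero)       = 2 *ℕ d
  configuration s d (suc (suc zero)) = s +ℕ d

  row₀-identity : ∀ s d → -[1+ 2 ] * s + (-[1+ 0 ] * (+ 2 * d) + (+ 3 * (s + d) + 0ℤ)) ≡ d
  row₀-identity = solve-∀

  row₁-identity : ∀ s e d → -[1+ 0 ] * s + (+ 0 * e + (+ 1 * (s + d) + 0ℤ)) ≡ d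
  row₁-identity = solve-∀

  A-configuration : ∀ s d i → (A · configuration s d) i ≡ + d
  A-configuration s d zero = begin
    -[1+ 2 ] * + s + (-[1+ 0 ] * + (2 *ℕ d) + (+ 3 * + (s +ℕ d) + 0ℤ))
      ≡⟨ cong₂ (λ p q → -[1+ 2 ] * + s + (-[1+ 0 ] * p + (+ 3 * q + 0ℤ))) (pos-* 2 d) (pos-+ s d) ⟩
    -[1+ 2 ] * + s + (-[1+ 0 ] * (+ 2 * + d) + (+ 3 * (+ s + + d) + 0ℤ))
      ≡⟨ row₀-identity (+ s) (+ d) ⟩
    + d ∎
    where open ≡-Reasoning
  A-configuration s d (suc zero) = begin
    -[1+ 0 ] * + s + (+ 0 * + (2 *ℕ d) + (+ 1 * + (s +ℕ d) + 0ℤ))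
      ≡⟨ cong (λ q → -[1+ 0 ] * + s + (+ 0 * + (2 *ℕ d) + (+ 1 * q + 0ℤ))) (pos-+ s d) ⟩
    -[1+ 0 ] * + s + (+ 0 * + (2 *ℕ d) + (+ 1 * (+ s + + d) + 0ℤ))
      ≡⟨ row₁-identity (+ s) (+ (2 *ℕ d)) (+ d) ⟩
    + d ∎
    where open ≡-Reasoning

  A-doublyImagePR : DoublyImagePR A
  A-doublyImagePR zero c with c 0
  ... | ()
  A-doublyImagePR (suc r) c with monochromaticTriple r
  ... | _ , triple with triple c
  ... | s , d , s>0 , d>0 , _ , _ , c[s+d]≡c[s] , c[2d]≡c[s] =
    configuration s d , (λ _ → d) , positive , (c s , monochromatic) , (λ _ → d>0) , (c d , λ _ → refl) ,
    A-configuration s d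
    where
    positive : Positive (configuration s d)
    positive zero             = s>0
    positive (suc zero)       = ≤-trans d>0 (m≤m+n d _)
    positive (suc (suc zero)) = ≤-trans s>0 (m≤m+n s d)
    monochromatic : ∀ j → c (configuration s d j) ≡ c s
    monochromatic zero             = refl
    monochromatic (suc zero)       = c[2d]≡c[s]
    monochromatic (suc (suc zero)) = c[s+d]≡c[s]

  elimination : ∀ x₀ x₁ x₂ x₃ x₄ b → x₁ + b * x₃ ≡
    + 3 * b * x₄
    - (-[1+ 2 ] * x₀ + (-[1+ 0 ] * x₁ + (+ 3 * x₂ + (- b * x₃ + (0ℤ * x₄ + 0ℤ)))))
    + + 3 * (-[1+ 0 ] * x₀ + (+ 0 * x₁ + (+ 1 * x₂ + (0ℤ * x₃ + (- b * x₄ + 0ℤ)))))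
  elimination = solve-∀

  z-0+3*0≡z : ∀ z → z - 0ℤ + + 3 * 0ℤ ≡ z
  z-0+3*0≡z = solve-∀

  -- 3 · row₁ − row₀
  kernel-equation : ∀ b (x : Fin 5 → ℕ) → (∀ i → (augment A b · x) i ≡ 0ℤ) →
                    x (suc zero) +ℕ b *ℕ x (suc (suc (suc zero))) ≡ 3 *ℕ b *ℕ x (suc (suc (suc (suc zero))))
  kernel-equation b x row≡0 = +-injective (begin
    + (x₁ +ℕ b *ℕ x₃)
      ≡⟨ trans (pos-+ x₁ (b *ℕ x₃)) (cong (_+_ (+ x₁)) (pos-* b x₃)) ⟩
    + x₁ + + b * + x₃
      ≡⟨ elimination (+ x₀) (+ x₁) (+ x₂) (+ x₃) (+ x₄) (+ b) ⟩
    + 3 * + b * + x₄ - row zero + + 3 * row (suc zero)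
      ≡⟨ cong₂ (λ r₀ r₁ → + 3 * + b * + x₄ - r₀ + + 3 * r₁) (row≡0 zero) (row≡0 (suc zero)) ⟩
    + 3 * + b * + x₄ - 0ℤ + + 3 * 0ℤ
      ≡⟨ z-0+3*0≡z (+ 3 * + b * + x₄) ⟩
    + 3 * + b * + x₄
      ≡⟨ trans (pos-* (3 *ℕ b) x₄) (cong (_* + x₄) (pos-* 3 b)) ⟨
    + (3 *ℕ b *ℕ x₄)
      ∎)
    where
    open ≡-Reasoning
    row = augment A b · x
    x₀ = x zero
    x₁ = x (suc zero)
    x₂ = x (suc (suc zero))
    x₃ = x (suc (suc (suc zero)))
    x₄ = x (suc (suc (suc (suc zero))))

  augment-A-not-kernelPR : ∀ b → b > 0 → ¬ KernelPR (augment A b)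
  augment-A-not-kernelPR b b>0 kernelPR with kernelPR _ colour
    where open TwoAdicColouring b b>0
  ... | x , positive , (_ , monochromatic) , kernel =
    colour-no-monochromatic-solution (positive _) (positive _) (positive _) (same-colour _ _) (same-colour _ _)
      (kernel-equation b x kernel)
    where
    open TwoAdicColouring b b>0
    same-colour : ∀ i j → colour (x i) ≡ colour (x j)
    same-colour i j = trans (monochromatic i) (sym (monochromatic j))

theorem3p4 : Σ (Matrix 2 3) λ A → DoublyImagePR A × ¬ (Σ ℕ λ b → b > 0 × KernelPR (augment A b))
theorem3p4 = A , A-doublyImagePR , λ (b , b>0 , kernelPR) → augment-A-not-kernelPR b b>0 kernelPR
  where open WitnessMatrix
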